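{- Let $G\le S_n$ be transitive with point stabilizer $H$, let $U<G$, and let $H=H_0<H_1<\cdots<H_r=G$ and $U=U_0<U_1<\cdots<U_s=G$ be chains of subgroups, each maximal in the next, with $r,s\ge1$. Assume that for each $i\in\{1,\dots,r\}$ the permutation group induced by the action of $H_i$ on the cosets of $H_{i-1}$ is nonsolvable, whereas for each $i\in\{1,\dots,s\}$ the permutation group induced by the action of $U_i$ on the cosets of $U_{i-1}$ is solvable. Then $U$ is transitive on $G/H$. -}

module Defs where

open import Level using (0ℓ; Level) renaming (suc to lsuc)
open import Data.Nat using (ℕ; zero; suc; _<_; _≤_)
open import Data.Fin using (Fin)
open import Data.Fin.Permutation using (Permutation′; _⟨$⟩ʳ_; id; flip; _∘ₚ_; _≈_)
open import Data.Product using (Σ; ∃; _×_; _,_)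
open import Data.Sum using (_⊎_)
open import Relation.Unary using (Pred; _∈_; _∉_; _⊆_; _≐_)
open import Relation.Binary.PropositionalEquality using (_≡_)

-- Elements of the symmetric group S_n: permutations of Fin n.
-- Composition π ∘ₚ ρ means "first π, then ρ"; flip π is the inverse.
Perm : ℕ → Set
Perm n = Permutation′ n

SubsetS : ℕ → Set₁
SubsetS n = Pred (Perm n) 0ℓ

module _ {n : ℕ} where

  record IsSubgroup (P : SubsetS n) : Set where
    field
      resp    : ∀ {π ρ} → π ≈ ρ → π ∈ P → ρ ∈ P
      id∈     : id ∈ P
      ∘-closed : ∀ {π ρ} → π ∈ P → ρ ∈ P → (π ∘ₚ ρ) ∈ P
      inv-closed : ∀ {π} → π ∈ P → flip π ∈ P

  ProperSubgroup : SubsetS n → SubsetS n → Set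
  ProperSubgroup H K = IsSubgroup H × IsSubgroup K × H ⊆ K × ∃ λ g → g ∈ K × g ∉ H

  IsMaximalIn : SubsetS n → SubsetS n → Set₁
  IsMaximalIn H K = ProperSubgroup H K ×
    (∀ (L : SubsetS n) → IsSubgroup L → H ⊆ L → L ⊆ K → (L ⊆ H) ⊎ (K ⊆ L))

  conj : Perm n → Perm n → Perm n
  conj k h = flip h ∘ₚ (k ∘ₚ h)

  comm : Perm n → Perm n → Perm n
  comm x y = flip x ∘ₚ (flip y ∘ₚ (x ∘ₚ y))

  -- Kernel of the action of K on the cosets of its subgroup H:
  -- k ∈ K fixing every coset, i.e. for all h ∈ K the coset of h is
  -- mapped to itself, equivalently conj k h ∈ H.
  ActionKernel : SubsetS n → SubsetS n → SubsetS n
  ActionKernel H K k = k ∈ K × (∀ h → h ∈ K → conj k h ∈ H)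

  IsNormalIn : SubsetS n → SubsetS n → Set
  IsNormalIn N M = IsSubgroup N × IsSubgroup M × N ⊆ M ×
    (∀ x m → x ∈ N → m ∈ M → conj x m ∈ N)

  -- The quotient group K / N (N normal in K) is solvable: there is a series
  -- N = N₀ ⊴ N₁ ⊴ ⋯ ⊴ N_m = K with every factor N_{j+1}/N_j abelian
  -- (i.e. all commutators of N_{j+1} lie in N_j).  By the correspondence
  -- theorem this is exactly a subnormal series of K/N with abelian factors.
  SolvableQuotient : SubsetS n → SubsetS n → Set₁
  SolvableQuotient N K = Σ ℕ λ m → Σ (ℕ → SubsetS n) λ Ns →
    (Ns 0 ≐ N) × (Ns m ≐ K) ×
    (∀ j → j < m → IsNormalIn (Ns j) (Ns (suc j))) ×
    (∀ j → j < m → ∀ x y → x ∈ Ns (suc j) → y ∈ Ns (suc j) → comm x y ∈ Ns j)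

  -- The permutation group induced by the action of K on the cosets of H
  -- is K / (kernel of that action); it is solvable iff this quotient is.
  InducedSolvable : SubsetS n → SubsetS n → Set₁
  InducedSolvable H K = SolvableQuotient (ActionKernel H K) K

  Stabilizer : SubsetS n → Fin n → SubsetS n
  Stabilizer G x g = g ∈ G × g ⟨$⟩ʳ x ≡ x

  Transitive : SubsetS n → Set
  Transitive G = ∀ x y → ∃ λ g → g ∈ G × g ⟨$⟩ʳ x ≡ y

module Submission where

-- Let N be the core of U in G (the kernel of G acting on the cosets of U).
-- Composing the solvable actions of U_i on U_{i-1}-cosets gives an abelian
-- series from N to G, i.e. G/N is solvable.  For each link H_{i-1} < H_i the
-- subgroup H_{i-1}(N ∩ H_i) lies between H_{i-1} and H_i; if it were H_{i-1},
-- then N ∩ H_i would lie in the core C of H_{i-1} in H_i, and H_i/C, a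
-- quotient of H_i/(N ∩ H_i) ≤ G/N, would be solvable, contradicting the
-- hypothesis.  By maximality H_i = H_{i-1}(N ∩ H_i), hence G = H N ⊆ H U,
-- which for the point stabilizer H says exactly that U is transitive.

open import Defs
open import Data.Nat using (ℕ; zero; suc; _≤_; _<_; z≤n; s≤s)
open import Data.Nat.Properties using (n<1+n; m<n⇒m<1+n; m<1+n⇒m≤n; m≤n⇒m<n∨m≡n)
open import Data.Fin using (Fin)
open import Data.Fin.Permutation using (_⟨$⟩ʳ_; _⟨$⟩ˡ_; inverseˡ; inverseʳ; id; flip; _∘ₚ_; _≈_)
open import Data.Product using (Σ; _×_; _,_; proj₁; proj₂)
open import Data.Sum using (_⊎_; inj₁; inj₂)
open import Data.Empty using (⊥-elim)
open import Relation.Unary using (_≐_; _⊆_; _∈_; _∩_)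
open import Relation.Unary.Properties using (≐-refl; ≐-sym; ≐-trans)
open import Relation.Nullary using (¬_)
open import Relation.Binary.PropositionalEquality using (_≡_; refl; sym; trans; cong)

open IsSubgroup

module _ {n : ℕ} where

  private
    Sub = SubsetS n

  conj-cong : {π ρ : Perm n} (g : Perm n) → π ≈ ρ → conj π g ≈ conj ρ g
  conj-cong g π≈ρ i = cong (g ⟨$⟩ʳ_) (π≈ρ (g ⟨$⟩ˡ i))

  conj-id : (g : Perm n) → id ≈ conj id g
  conj-id g i = sym (inverseʳ g)

  conj-∘ : (a b g : Perm n) → (conj a g ∘ₚ conj b g) ≈ conj (a ∘ₚ b) g
  conj-∘ a b g i = cong (λ z → g ⟨$⟩ʳ (b ⟨$⟩ʳ z)) (inverseˡ g)

  conj-comm : (x y g : Perm n) → comm (conj x g) (conj y g) ≈ conj (comm x y) g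
  conj-comm x y g i =
    trans (cong (λ z → g ⟨$⟩ʳ (y ⟨$⟩ʳ z)) (inverseˡ g))
      (trans (cong (λ z → g ⟨$⟩ʳ (y ⟨$⟩ʳ (x ⟨$⟩ʳ z))) (inverseˡ g))
        (cong (λ z → g ⟨$⟩ʳ (y ⟨$⟩ʳ (x ⟨$⟩ʳ (y ⟨$⟩ˡ z)))) (inverseˡ g)))

  ∘-congˡ : {π ρ : Perm n} (a : Perm n) → π ≈ ρ → (a ∘ₚ π) ≈ (a ∘ₚ ρ)
  ∘-congˡ a π≈ρ i = π≈ρ (a ⟨$⟩ʳ i)

  cancelˡ : (a c : Perm n) → c ≈ (flip a ∘ₚ (a ∘ₚ c))
  cancelˡ a c i = cong (c ⟨$⟩ʳ_) (sym (inverseʳ a))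

  unfactor : (a g : Perm n) → (a ∘ₚ (flip a ∘ₚ g)) ≈ g
  unfactor a g i = cong (g ⟨$⟩ʳ_) (inverseˡ a)

  cancel-middle : (w a g : Perm n) → ((flip w ∘ₚ a) ∘ₚ (flip a ∘ₚ g)) ≈ (flip w ∘ₚ g)
  cancel-middle w a g i = cong (g ⟨$⟩ʳ_) (inverseˡ a)

  -- (ab)⁻¹(xy) = (b⁻¹ (a⁻¹x) b)(b⁻¹y): cosets multiply.
  coset-∘-identity : (a b x y : Perm n) →
    (conj (flip a ∘ₚ x) b ∘ₚ (flip b ∘ₚ y)) ≈ (flip (a ∘ₚ b) ∘ₚ (x ∘ₚ y))
  coset-∘-identity a b x y i = cong (y ⟨$⟩ʳ_) (inverseˡ b)

  -- (a⁻¹)⁻¹ x⁻¹ = a (x⁻¹ a) a⁻¹: cosets invert.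
  coset-flip-identity : (a x : Perm n) →
    conj (flip (flip a ∘ₚ x)) (flip a) ≈ (flip (flip a) ∘ₚ flip x)
  coset-flip-identity a x i = inverseˡ a

  flip-fixes : (h : Perm n) {x : Fin n} → h ⟨$⟩ʳ x ≡ x → h ⟨$⟩ˡ x ≡ x
  flip-fixes h hx = trans (cong (h ⟨$⟩ˡ_) (sym hx)) (inverseˡ h)

  conj-closed : {P : Sub} → IsSubgroup P → ∀ {x m} → x ∈ P → m ∈ P → conj x m ∈ P
  conj-closed sP x∈P m∈P = ∘-closed sP (inv-closed sP m∈P) (∘-closed sP x∈P m∈P)

  comm-closed : {P : Sub} → IsSubgroup P → ∀ {x y} → x ∈ P → y ∈ P → comm x y ∈ P
  comm-closed sP x∈P y∈P =
    ∘-closed sP (inv-closed sP x∈P) (∘-closed sP (inv-closed sP y∈P) (∘-closed sP x∈P y∈P))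

  subgroup-resp : {P Q : Sub} → P ≐ Q → IsSubgroup P → IsSubgroup Q
  subgroup-resp (P⊆Q , Q⊆P) sP = record
    { resp       = λ π≈ρ π∈Q → P⊆Q (resp sP π≈ρ (Q⊆P π∈Q))
    ; id∈        = P⊆Q (id∈ sP)
    ; ∘-closed   = λ π∈Q ρ∈Q → P⊆Q (∘-closed sP (Q⊆P π∈Q) (Q⊆P ρ∈Q))
    ; inv-closed = λ π∈Q → P⊆Q (inv-closed sP (Q⊆P π∈Q))
    }

  ∩-subgroup : {P Q : Sub} → IsSubgroup P → IsSubgroup Q → IsSubgroup (P ∩ Q)
  ∩-subgroup sP sQ = record
    { resp       = λ π≈ρ (π∈P , π∈Q) → resp sP π≈ρ π∈P , resp sQ π≈ρ π∈Q
    ; id∈        = id∈ sP , id∈ sQ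
    ; ∘-closed   = λ (π∈P , π∈Q) (ρ∈P , ρ∈Q) → ∘-closed sP π∈P ρ∈P , ∘-closed sQ π∈Q ρ∈Q
    ; inv-closed = λ (π∈P , π∈Q) → inv-closed sP π∈P , inv-closed sQ π∈Q
    }

  normal-conj : {N M : Sub} → IsNormalIn N M → ∀ {x m} → x ∈ N → m ∈ M → conj x m ∈ N
  normal-conj (_ , _ , _ , normalised) x∈N m∈M = normalised _ _ x∈N m∈M

  normal-resp : {A A' M : Sub} → A' ≐ A → IsNormalIn A M → IsNormalIn A' M
  normal-resp (A'⊆A , A⊆A') (sA , sM , A⊆M , normalised) =
    subgroup-resp (A⊆A' , A'⊆A) sA , sM , (λ x∈A' → A⊆M (A'⊆A x∈A')) ,
    λ x m x∈A' m∈M → A⊆A' (normalised x m (A'⊆A x∈A') m∈M)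

  ∩-normal : {N G K : Sub} → IsNormalIn N G → IsSubgroup K → K ⊆ G → IsNormalIn (N ∩ K) K
  ∩-normal (sN , _ , _ , normalised) sK K⊆G =
    ∩-subgroup sN sK , sK , proj₂ ,
    λ x m (x∈N , x∈K) m∈K → normalised x m x∈N (K⊆G m∈K) , conj-closed sK x∈K m∈K

  -- The core of H in K: 'ActionKernel H K', the largest normal subgroup of K
  -- contained in H.

  core-subgroup : {H K : Sub} → IsSubgroup H → IsSubgroup K → IsSubgroup (ActionKernel H K)
  core-subgroup sH sK = record
    { resp       = λ {π} {ρ} π≈ρ (π∈K , π-fixes) →
                     resp sK π≈ρ π∈K , λ h h∈K → resp sH (conj-cong {π} {ρ} h π≈ρ) (π-fixes h h∈K)
    ; id∈        = id∈ sK , λ h _ → resp sH (conj-id h) (id∈ sH)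
    ; ∘-closed   = λ {a} {b} (a∈K , a-fixes) (b∈K , b-fixes) →
                     ∘-closed sK a∈K b∈K ,
                     λ h h∈K → resp sH (conj-∘ a b h) (∘-closed sH (a-fixes h h∈K) (b-fixes h h∈K))
    ; inv-closed = λ (a∈K , a-fixes) →
                     inv-closed sK a∈K , λ h h∈K → inv-closed sH (a-fixes h h∈K)
    }

  core-normal : {H K : Sub} → IsSubgroup H → IsSubgroup K → IsNormalIn (ActionKernel H K) K
  core-normal sH sK =
    core-subgroup sH sK , sK , proj₁ ,
    λ x m (x∈K , x-fixes) m∈K →
      conj-closed sK x∈K m∈K , λ h h∈K → x-fixes (m ∘ₚ h) (∘-closed sK m∈K h∈K)

  core-⊆ : {H K : Sub} → IsSubgroup K → ActionKernel H K ⊆ H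
  core-⊆ sK (_ , x-fixes) = x-fixes id (id∈ sK)

  core-mono : {H H' K : Sub} → H ⊆ H' → ActionKernel H K ⊆ ActionKernel H' K
  core-mono H⊆H' (x∈K , x-fixes) = x∈K , λ h h∈K → H⊆H' (x-fixes h h∈K)

  normal⊆core : {M H K : Sub} → IsNormalIn M K → M ⊆ H → M ⊆ ActionKernel H K
  normal⊆core (_ , _ , M⊆K , normalised) M⊆H x∈M =
    M⊆K x∈M , λ h h∈K → M⊆H (normalised _ h x∈M h∈K)

  core-whole : {K : Sub} → IsSubgroup K → ActionKernel K K ≐ K
  core-whole sK = proj₁ , λ x∈K → x∈K , λ h h∈K → conj-closed sK x∈K h∈K

  core-core : {A M G : Sub} → IsSubgroup M → IsSubgroup G → A ⊆ M → M ⊆ G →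
    ActionKernel A G ≐ ActionKernel (ActionKernel A M) G
  core-core sM sG A⊆M M⊆G =
    (λ (x∈G , x-fixes) → x∈G , λ g g∈G →
       A⊆M (x-fixes g g∈G) , λ h h∈M → x-fixes (g ∘ₚ h) (∘-closed sG g∈G (M⊆G h∈M))) ,
    (λ (x∈G , x-fixes) → x∈G , λ g g∈G → proj₂ (x-fixes g g∈G) id (id∈ sM))

  -- g lies in the coset aC, i.e. a⁻¹g ∈ C.  (A record, so that a and g
  -- can be inferred from a proof.)
  record InCoset (C : Sub) (a g : Perm n) : Set where
    constructor incoset
    field
      quotient∈ : (flip a ∘ₚ g) ∈ C

  infixl 7 _·_
  _·_ : Sub → Sub → Sub
  (X · C) g = Σ (Perm n) λ a → a ∈ X × InCoset C a g

  ·-mono : {X X' C C' : Sub} → X ⊆ X' → C ⊆ C' → X · C ⊆ X' · C'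
  ·-mono X⊆X' C⊆C' (a , a∈X , incoset ag∈C) = a , X⊆X' a∈X , incoset (C⊆C' ag∈C)

  ·-⊇ˡ : {X C : Sub} → IsSubgroup C → X ⊆ X · C
  ·-⊇ˡ sC {a} a∈X = a , a∈X , incoset (resp sC (cancelˡ a id) (id∈ sC))

  ·-⊇ʳ : {X C : Sub} → IsSubgroup X → C ⊆ X · C
  ·-⊇ʳ sX c∈C = id , id∈ sX , incoset c∈C

  ·-⊆ : {X C Y : Sub} → IsSubgroup Y → X ⊆ Y → C ⊆ Y → X · C ⊆ Y
  ·-⊆ sY X⊆Y C⊆Y {g} (a , a∈X , incoset ag∈C) =
    resp sY (unfactor a g) (∘-closed sY (X⊆Y a∈X) (C⊆Y ag∈C))

  ·-trans : {Y X W N : Sub} → IsSubgroup N → Y ⊆ X · N → X ⊆ W · N → Y ⊆ W · N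
  ·-trans sN Y⊆XN X⊆WN {g} g∈Y with Y⊆XN g∈Y
  ... | a , a∈X , incoset ag∈N with X⊆WN a∈X
  ... | w , w∈W , incoset wa∈N =
    w , w∈W , incoset (resp sN (cancel-middle w a g) (∘-closed sN wa∈N ag∈N))

  -- For C normal in K, lying in the same coset of C is a congruence on K,
  -- so X·C is a subgroup for X ≤ K, and normality and commutator relations
  -- between subgroups of K pass to their products with C.
  module ModuloNormal {C K : Sub} (sK : IsSubgroup K) (C⊴K : IsNormalIn C K) where

    private
      sC : IsSubgroup C
      sC = proj₁ C⊴K

    coset-∘ : ∀ {a b x y} → b ∈ K → InCoset C a x → InCoset C b y → InCoset C (a ∘ₚ b) (x ∘ₚ y)
    coset-∘ {a} {b} {x} {y} b∈K (incoset ax∈C) (incoset by∈C) =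
      incoset (resp sC (coset-∘-identity a b x y) (∘-closed sC (normal-conj C⊴K ax∈C b∈K) by∈C))

    coset-flip : ∀ {a x} → a ∈ K → InCoset C a x → InCoset C (flip a) (flip x)
    coset-flip {a} {x} a∈K (incoset ax∈C) =
      incoset (resp sC (coset-flip-identity a x)
                 (normal-conj C⊴K (inv-closed sC ax∈C) (inv-closed sK a∈K)))

    coset-conj : ∀ {a b x m} → a ∈ K → b ∈ K → InCoset C a x → InCoset C b m →
      InCoset C (conj a b) (conj x m)
    coset-conj a∈K b∈K ax by =
      coset-∘ (∘-closed sK a∈K b∈K) (coset-flip b∈K by) (coset-∘ b∈K ax by)

    coset-comm : ∀ {a b x y} → a ∈ K → b ∈ K → InCoset C a x → InCoset C b y →
      InCoset C (comm a b) (comm x y)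
    coset-comm a∈K b∈K ax by =
      coset-∘ (∘-closed sK (inv-closed sK b∈K) (∘-closed sK a∈K b∈K)) (coset-flip a∈K ax)
        (coset-∘ (∘-closed sK a∈K b∈K) (coset-flip b∈K by) (coset-∘ b∈K ax by))

    ·-subgroup : {X : Sub} → IsSubgroup X → X ⊆ K → IsSubgroup (X · C)
    ·-subgroup sX X⊆K = record
      { resp       = λ {π} {ρ} π≈ρ (a , a∈X , incoset aπ∈C) →
                       a , a∈X , incoset (resp sC (∘-congˡ {π} {ρ} (flip a) π≈ρ) aπ∈C)
      ; id∈        = ·-⊇ˡ sC (id∈ sX)
      ; ∘-closed   = λ (a , a∈X , ax) (b , b∈X , by) →
                       a ∘ₚ b , ∘-closed sX a∈X b∈X , coset-∘ (X⊆K b∈X) ax by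
      ; inv-closed = λ (a , a∈X , ax) → flip a , inv-closed sX a∈X , coset-flip (X⊆K a∈X) ax
      }

  AbelianOver : Sub → Sub → Set
  AbelianOver M A = ∀ x y → x ∈ M → y ∈ M → comm x y ∈ A

  AbelianExtension : Sub → Sub → Set
  AbelianExtension A M = IsNormalIn A M × AbelianOver M A

  core-extension : {A M G : Sub} → IsSubgroup G → AbelianExtension A M →
    AbelianExtension (ActionKernel A G) (ActionKernel M G)
  core-extension {A} {M} {G} sG ((sA , sM , A⊆M , _) , abelian) =
    (core-subgroup sA sG , core-subgroup sM sG , core-mono {A} {M} {G} A⊆M ,
     λ x m x∈core (m∈G , _) → normal-conj (core-normal sA sG) {x} {m} x∈core m∈G) ,
    λ x y (x∈G , x-fixes) (y∈G , y-fixes) →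
      comm-closed sG x∈G y∈G ,
      λ h h∈G → resp sA (conj-comm x y h) (abelian (conj x h) (conj y h) (x-fixes h h∈G) (y-fixes h h∈G))

  ∩-extension : {A M K : Sub} → IsSubgroup K → AbelianExtension A M →
    AbelianExtension (A ∩ K) (M ∩ K)
  ∩-extension sK ((sA , sM , A⊆M , normalised) , abelian) =
    (∩-subgroup sA sK , ∩-subgroup sM sK , (λ (x∈A , x∈K) → A⊆M x∈A , x∈K) ,
     λ x m (x∈A , x∈K) (m∈M , m∈K) → normalised x m x∈A m∈M , conj-closed sK x∈K m∈K) ,
    λ x y (x∈M , x∈K) (y∈M , y∈K) → abelian x y x∈M y∈M , comm-closed sK x∈K y∈K

  ·-extension : {A M C K : Sub} → IsSubgroup K → IsNormalIn C K → M ⊆ K →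
    AbelianExtension A M → AbelianExtension (A · C) (M · C)
  ·-extension sK C⊴K M⊆K ((sA , sM , A⊆M , normalised) , abelian) =
    (·-subgroup sA (λ a∈A → M⊆K (A⊆M a∈A)) , ·-subgroup sM M⊆K , ·-mono A⊆M (λ c∈C → c∈C) ,
     λ _ _ (a , a∈A , ax) (b , b∈M , bm) →
       conj a b , normalised a b a∈A b∈M , coset-conj (M⊆K (A⊆M a∈A)) (M⊆K b∈M) ax bm) ,
    λ _ _ (a , a∈M , ax) (b , b∈M , by) →
      comm a b , abelian a b a∈M b∈M , coset-comm (M⊆K a∈M) (M⊆K b∈M) ax by
    where open ModuloNormal sK C⊴K

  -- An abelian series A = A₀ ⊴ A₁ ⊴ ⋯ ⊴ A_m ≐ B with abelian factors.  It is
  -- equivalent to 'SolvableQuotient A B' (B/A is solvable) but can be built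
  -- and transformed by structural recursion.
  infixr 5 _∷_
  data AbelianSeries (A B : Sub) : Set₁ where
    stop : A ≐ B → AbelianSeries A B
    _∷_  : {M : Sub} → AbelianExtension A M → AbelianSeries M B → AbelianSeries A B

  series-⊆ : {A B : Sub} → AbelianSeries A B → A ⊆ B
  series-⊆ (stop (A⊆B , _))                 = A⊆B
  series-⊆ (((_ , _ , A⊆M , _) , _) ∷ rest) = λ a∈A → series-⊆ rest (A⊆M a∈A)

  series-resp-bottom : {A A' B : Sub} → A' ≐ A → AbelianSeries A B → AbelianSeries A' B
  series-resp-bottom A'≐A (stop A≐B)                 = stop (≐-trans A'≐A A≐B)
  series-resp-bottom A'≐A ((A⊴M , abelian) ∷ rest) =
    (normal-resp A'≐A A⊴M , λ x y x∈M y∈M → proj₂ A'≐A (abelian x y x∈M y∈M)) ∷ rest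

  series-resp-top : {A B B' : Sub} → AbelianSeries A B → B ≐ B' → AbelianSeries A B'
  series-resp-top (stop A≐B)   B≐B' = stop (≐-trans A≐B B≐B')
  series-resp-top (ext ∷ rest) B≐B' = ext ∷ series-resp-top rest B≐B'

  infixr 5 _++_
  _++_ : {A B D : Sub} → AbelianSeries A B → AbelianSeries B D → AbelianSeries A D
  stop A≐B     ++ rest' = series-resp-bottom A≐B rest'
  (ext ∷ rest) ++ rest' = ext ∷ (rest ++ rest')

  map-series : {A B : Sub} (F : Sub → Sub) → (∀ {X Y} → X ⊆ Y → F X ⊆ F Y) →
    (∀ {X M} → M ⊆ B → AbelianExtension X M → AbelianExtension (F X) (F M)) →
    AbelianSeries A B → AbelianSeries (F A) (F B)
  map-series F mono extension (stop (A⊆B , B⊆A)) = stop (mono A⊆B , mono B⊆A)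
  map-series F mono extension (ext ∷ rest) =
    extension (series-⊆ rest) ext ∷ map-series F mono extension rest

  chain-series : (m : ℕ) (Ns : ℕ → Sub) → (∀ j → j < m → AbelianExtension (Ns j) (Ns (suc j))) →
    AbelianSeries (Ns 0) (Ns m)
  chain-series zero    Ns _          = stop ≐-refl
  chain-series (suc m) Ns extensions =
    extensions 0 (s≤s z≤n) ∷ chain-series m (λ j → Ns (suc j)) (λ j j<m → extensions (suc j) (s≤s j<m))

  solvable→series : {A B : Sub} → SolvableQuotient A B → AbelianSeries A B
  solvable→series (m , Ns , N₀≐A , Nₘ≐B , normal , abelian) =
    series-resp-bottom (≐-sym N₀≐A)
      (series-resp-top (chain-series m Ns (λ j j<m → normal j j<m , abelian j j<m)) Nₘ≐B)

  -- Conversely, the members of a series form the chain demanded by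
  -- 'SolvableQuotient' (continued constantly past the top).
  series-length : {A B : Sub} → AbelianSeries A B → ℕ
  series-length (stop _)     = zero
  series-length (_ ∷ rest)   = suc (series-length rest)

  member : {A B : Sub} → AbelianSeries A B → ℕ → Sub
  member {A} _          zero    = A
  member {A} (stop _)   (suc j) = A
  member (_ ∷ rest)     (suc j) = member rest j

  member-top : {A B : Sub} (S : AbelianSeries A B) → member S (series-length S) ≐ B
  member-top (stop A≐B)  = A≐B
  member-top (_ ∷ rest)  = member-top rest

  member-extension : {A B : Sub} (S : AbelianSeries A B) → ∀ j → j < series-length S →
    AbelianExtension (member S j) (member S (suc j))
  member-extension (ext ∷ rest) zero    _         = ext
  member-extension (_ ∷ rest)   (suc j) (s≤s j<m) = member-extension rest j j<m

  series→solvable : {A B : Sub} → AbelianSeries A B → SolvableQuotient A B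
  series→solvable S =
    series-length S , member S , ≐-refl , member-top S ,
    (λ j j<m → proj₁ (member-extension S j j<m)) , (λ j j<m → proj₂ (member-extension S j j<m))

  -- If G/N is solvable, K ≤ G and C ⊴ K with N ∩ K ⊆ C, then K/C is solvable:
  -- K/C is a quotient of K/(N ∩ K), which embeds in G/N.  Concretely, a
  -- series from N to G is intersected with K and then multiplied by C.
  quotient-series : {N G K C : Sub} → IsSubgroup N → IsSubgroup K → K ⊆ G → IsNormalIn C K →
    (N ∩ K) ⊆ C → AbelianSeries N G → AbelianSeries C K
  quotient-series {N = N} {K = K} {C = C} sN sK K⊆G C⊴K N∩K⊆C N-to-G =
    series-resp-bottom bottom (series-resp-top lifted top)
    where
    sC : IsSubgroup C
    sC = proj₁ C⊴K

    C⊆K : C ⊆ K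
    C⊆K = proj₁ (proj₂ (proj₂ C⊴K))

    restricted : AbelianSeries (N ∩ K) K
    restricted =
      series-resp-top
        (map-series (_∩ K) (λ X⊆Y (x∈X , x∈K) → X⊆Y x∈X , x∈K) (λ _ → ∩-extension sK) N-to-G)
        (proj₂ , λ x∈K → K⊆G x∈K , x∈K)

    lifted : AbelianSeries ((N ∩ K) · C) (K · C)
    lifted = map-series (_· C) (λ X⊆Y → ·-mono X⊆Y (λ c∈C → c∈C)) (·-extension sK C⊴K) restricted

    bottom : C ≐ (N ∩ K) · C
    bottom = ·-⊇ʳ (∩-subgroup sN sK) , ·-⊆ sC N∩K⊆C (λ c∈C → c∈C)

    top : K · C ≐ K
    top = ·-⊆ sK (λ k∈K → k∈K) C⊆K , ·-⊇ˡ sC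

  -- Then K = H(N ∩ K):
  -- that product lies between H and K, and were it H, then N ∩ K would lie
  -- in the core of H in K, making the induced group solvable.
  maximal-step : {N G H K : Sub} → IsNormalIn N G → AbelianSeries N G → K ⊆ G →
    IsMaximalIn H K → ¬ InducedSolvable H K → K ⊆ H · (N ∩ K)
  maximal-step {N = N} {H = H} {K = K} N⊴G N-to-G K⊆G ((sH , sK , H⊆K , _) , maximal) nonsolvable =
    decide (maximal (H · (N ∩ K)) (·-subgroup sH H⊆K) (·-⊇ˡ (proj₁ N∩K⊴K)) (·-⊆ sK H⊆K proj₂))
    where
    sN : IsSubgroup N
    sN = proj₁ N⊴G

    N∩K⊴K : IsNormalIn (N ∩ K) K
    N∩K⊴K = ∩-normal N⊴G sK K⊆G

    open ModuloNormal sK N∩K⊴K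

    decide : (H · (N ∩ K) ⊆ H) ⊎ (K ⊆ H · (N ∩ K)) → K ⊆ H · (N ∩ K)
    decide (inj₂ K⊆H[N∩K]) = K⊆H[N∩K]
    decide (inj₁ H[N∩K]⊆H) =
      ⊥-elim (nonsolvable (series→solvable
        (quotient-series sN sK K⊆G (core-normal sH sK) N∩K⊆core N-to-G)))
      where
      N∩K⊆core : (N ∩ K) ⊆ ActionKernel H K
      N∩K⊆core = normal⊆core {H = H} N∩K⊴K (λ x∈N∩K → H[N∩K]⊆H (·-⊇ʳ sH x∈N∩K))

  chain-⊆ : (s : ℕ) (Xs : ℕ → Sub) → (∀ j → j < s → Xs j ⊆ Xs (suc j)) →
    ∀ i → i ≤ s → Xs i ⊆ Xs s
  chain-⊆ zero    Xs _     zero z≤n = λ x∈X → x∈X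
  chain-⊆ (suc s) Xs links i i≤1+s with m≤n⇒m<n∨m≡n i≤1+s
  ... | inj₂ refl  = λ x∈X → x∈X
  ... | inj₁ i<1+s = λ x∈Xᵢ → links s (n<1+n s) (below x∈Xᵢ)
    where
    below : Xs i ⊆ Xs s
    below = chain-⊆ s Xs (λ j j<s → links j (m<n⇒m<1+n j<s)) i (m<1+n⇒m≤n i<1+s)

  -- If U₀ ≤ U₁ ≤ ⋯ ≤ U_s ≐ G and each U_{j+1} acts solvably on the cosets
  -- of U_j, then G is solvable modulo the core of U₀: the series of the
  -- individual actions, carried into G by taking cores, are concatenated,
  -- using core_G(U_j) = core_G(core_{U_{j+1}}(U_j)).
  core-series : {G : Sub} → IsSubgroup G → (s : ℕ) (Us : ℕ → Sub) → Us s ≐ G →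
    (∀ j → j < s → (IsSubgroup (Us (suc j)) × Us j ⊆ Us (suc j)) × InducedSolvable (Us j) (Us (suc j))) →
    AbelianSeries (ActionKernel (Us 0) G) G
  core-series {G} sG zero Us (U₀⊆G , G⊆U₀) _ =
    stop (≐-trans (core-mono {Us 0} {G} {G} U₀⊆G , core-mono {G} {Us 0} {G} G⊆U₀) (core-whole sG))
  core-series {G} sG (suc s) Us Uₛ≐G links =
    series-resp-bottom (core-core sU₁ sG U₀⊆U₁ U₁⊆G)
      (map-series (λ X → ActionKernel X G) (core-mono {K = G}) (λ _ → core-extension sG)
        (solvable→series solvable₀))
    ++ core-series sG s (λ j → Us (suc j)) Uₛ≐G (λ j j<s → links (suc j) (s≤s j<s))
    where
    sU₁ : IsSubgroup (Us 1)
    sU₁ = proj₁ (proj₁ (links 0 (s≤s z≤n)))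

    U₀⊆U₁ : Us 0 ⊆ Us 1
    U₀⊆U₁ = proj₂ (proj₁ (links 0 (s≤s z≤n)))

    solvable₀ : InducedSolvable (Us 0) (Us 1)
    solvable₀ = proj₂ (links 0 (s≤s z≤n))

    U₁⊆G : Us 1 ⊆ G
    U₁⊆G u∈U₁ = proj₁ Uₛ≐G
      (chain-⊆ s (λ j → Us (suc j)) (λ j j<s → proj₂ (proj₁ (links (suc j) (s≤s j<s)))) 0 z≤n u∈U₁)

  chain-factorises : {N : Sub} → IsSubgroup N → (Xs : ℕ → Sub) → ∀ i →
    (∀ j → j < i → Xs (suc j) ⊆ Xs j · N) → Xs i ⊆ Xs 0 · N
  chain-factorises sN Xs zero    _     = ·-⊇ˡ sN
  chain-factorises sN Xs (suc i) links =
    ·-trans sN (links i (n<1+n i)) (chain-factorises sN Xs i (λ j j<i → links j (m<n⇒m<1+n j<i)))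

  -- If G is transitive and G ⊆ G_x U, then U alone moves x to every point:
  -- for g = h u with h fixing x, u x = g x.
  orbit-of-factorisation : {G U : Sub} {x : Fin n} → Transitive G → G ⊆ Stabilizer G x · U →
    ∀ y → Σ (Perm n) λ u → u ∈ U × u ⟨$⟩ʳ x ≡ y
  orbit-of-factorisation {x = x} G-transitive G⊆GₓU y with G-transitive x y
  ... | g , g∈G , gx≡y with G⊆GₓU g∈G
  ... | h , (_ , hx≡x) , incoset hg∈U =
    flip h ∘ₚ g , hg∈U , trans (cong (g ⟨$⟩ʳ_) (flip-fixes h hx≡x)) gx≡y

  transitive-from-orbit : {U : Sub} {x : Fin n} → IsSubgroup U →
    (∀ y → Σ (Perm n) λ u → u ∈ U × u ⟨$⟩ʳ x ≡ y) → Transitive U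
  transitive-from-orbit sU orbit y z with orbit y | orbit z
  ... | u , u∈U , ux≡y | v , v∈U , vx≡z =
    flip u ∘ₚ v , ∘-closed sU (inv-closed sU u∈U) v∈U ,
    trans (cong (v ⟨$⟩ʳ_) (trans (cong (u ⟨$⟩ˡ_) (sym ux≡y)) (inverseˡ u))) vx≡z

lemma3p6 : (n : ℕ) (G U : SubsetS n) (x : Fin n) →
    IsSubgroup G → Transitive G → ProperSubgroup U G →
    (r s : ℕ) → 1 ≤ r → 1 ≤ s →
    (Hs Us : ℕ → SubsetS n) →
    Hs 0 ≐ Stabilizer G x → Hs r ≐ G →
    Us 0 ≐ U → Us s ≐ G →
    (∀ i → i < r → IsMaximalIn (Hs i) (Hs (suc i)) × ¬ InducedSolvable (Hs i) (Hs (suc i))) →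
    (∀ i → i < s → IsMaximalIn (Us i) (Us (suc i)) × InducedSolvable (Us i) (Us (suc i))) →
    Transitive U
lemma3p6 n G U x sG G-transitive (sU , _) r s _ _ Hs Us H₀≐Gₓ Hᵣ≐G U₀≐U Uₛ≐G H-links U-links =
  transitive-from-orbit sU (orbit-of-factorisation G-transitive G⊆GₓU)
  where
  N : SubsetS n
  N = ActionKernel (Us 0) G

  N⊴G : IsNormalIn N G
  N⊴G = core-normal (subgroup-resp (≐-sym U₀≐U) sU) sG

  G/N-solvable : AbelianSeries N G
  G/N-solvable = core-series sG s Us Uₛ≐G λ j j<s →
    let ((_ , sUⱼ₊₁ , Uⱼ⊆Uⱼ₊₁ , _) , _) , solvable = U-links j j<s in (sUⱼ₊₁ , Uⱼ⊆Uⱼ₊₁) , solvable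

  Hᵢ₊₁⊆G : ∀ i → i < r → Hs (suc i) ⊆ G
  Hᵢ₊₁⊆G i i<r h∈H = proj₁ Hᵣ≐G (chain-⊆ r Hs Hⱼ⊆Hⱼ₊₁ (suc i) i<r h∈H)
    where
    Hⱼ⊆Hⱼ₊₁ : ∀ j → j < r → Hs j ⊆ Hs (suc j)
    Hⱼ⊆Hⱼ₊₁ j j<r = proj₁ (proj₂ (proj₂ (proj₁ (proj₁ (H-links j j<r)))))

  H-absorbs-N : ∀ i → i < r → Hs (suc i) ⊆ Hs i · N
  H-absorbs-N i i<r h∈H = ·-mono (λ a∈H → a∈H) proj₁
    (maximal-step N⊴G G/N-solvable (Hᵢ₊₁⊆G i i<r) (proj₁ (H-links i i<r)) (proj₂ (H-links i i<r)) h∈H)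

  G⊆GₓU : G ⊆ Stabilizer G x · U
  G⊆GₓU g∈G = ·-mono (proj₁ H₀≐Gₓ) (λ u∈N → proj₁ U₀≐U (core-⊆ {H = Us 0} sG u∈N))
    (chain-factorises (proj₁ N⊴G) Hs r H-absorbs-N (proj₂ Hᵣ≐G g∈G))
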